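{- Let $G$ be a finite tree with a proper edge coloring $\kappa:E(G)\to[k]$. If $G$ contains a symmetric edge, then $\mathfrak{G}_\kappa= S_{V(G)}$.
   Context: A proper edge coloring of $G$ on $k$ colors is a surjective map $\kappa:E(G)\to[k]$ such that edges sharing a vertex receive different colors. For $a\in[k]$, $\tau_a\in S_{V(G)}$ is the product of the transpositions $(i,j)$ over all edges $\{i,j\}$ colored $a$, and the coloring group $\mathfrak{G}_\kappa\le S_{V(G)}$ is the subgroup generated by $\tau_1,\dots,\tau_k$. An edge $e$ of $G$ is called a symmetric edge if all edges incident to $e$ (i.e. sharing an endpoint with $e$, other than $e$ itself) have pairwise distinct colors, and there exists a subset $S\subseteq[k]$ that contains the colors of all edges incident to $e$ but does not contain $\kappa(e)$, such that deleting all edges whose color lies in $S$ (keeping all vertices) leaves a graph with exactly one connected component of even order. -}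

module Defs where

open import Level using (0ℓ)
open import Data.Nat using (ℕ)
open import Data.Nat.Divisibility using (_∣_)
open import Data.Fin using (Fin; _<_; _<?_)
open import Data.Fin.Properties using (_≟_)
open import Data.Fin.Subset using (Subset; _∈_; _∉_; ∣_∣)
open import Data.Fin.Permutation using (Permutation′; transpose; id; flip; _∘ₚ_; _⟨$⟩ʳ_)
open import Data.Maybe using (Maybe; just; nothing)
import Data.Maybe.Properties as MaybeP
open import Data.List using (List; []; _∷_; _++_; [_]; allFin; filter; cartesianProduct; foldr)
open import Data.List.Relation.Unary.Unique.Propositional using (Unique)
open import Data.List.Relation.Unary.Linked using (Linked)
open import Data.Product using (Σ; ∃; ∃-syntax; _×_; _,_; proj₁; proj₂)
open import Data.Sum using (_⊎_)
open import Data.Empty using (⊥)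
open import Relation.Nullary using (¬_; Dec; yes; no)
open import Relation.Nullary.Decidable using (_×-dec_)
open import Relation.Binary.PropositionalEquality using (_≡_; _≢_)
open import Relation.Binary.Construct.Closure.ReflexiveTransitive using (Star)
open import Function.Bundles using (_⇔_)

-- An edge-coloured simple graph on vertex set Fin n with colours Fin k
-- is given by  col : Fin n → Fin n → Maybe (Fin k):
--   col x y ≡ nothing   : {x,y} is not an edge
--   col x y ≡ just a    : {x,y} is an edge of colour a

Colouring : ℕ → ℕ → Set
Colouring n k = Fin n → Fin n → Maybe (Fin k)

module _ {n k : ℕ} (col : Colouring n k) where

  Adj : Fin n → Fin n → Set
  Adj x y = ∃[ a ] col x y ≡ just a

  IsSimpleGraph : Set
  IsSimpleGraph = (∀ x y → col x y ≡ col y x) × (∀ x → col x x ≡ nothing)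

  IsProper : Set
  IsProper = ∀ x y y' a → col x y ≡ just a → col x y' ≡ just a → y ≡ y'

  IsSurjective : Set
  IsSurjective = ∀ (a : Fin k) → ∃[ x ] ∃[ y ] col x y ≡ just a

  Connected : Set
  Connected = ∀ x y → Star Adj x y

  IsCycle : List (Fin n) → Set
  IsCycle [] = ⊥
  IsCycle (v ∷ []) = ⊥
  IsCycle (v ∷ w ∷ []) = ⊥
  IsCycle (v ∷ w ∷ x ∷ rest) =
    Unique (v ∷ w ∷ x ∷ rest) × Linked Adj ((v ∷ w ∷ x ∷ rest) ++ [ v ])

  Acyclic : Set
  Acyclic = ∀ (vs : List (Fin n)) → ¬ IsCycle vs

  IsTree : Set
  IsTree = Connected × Acyclic

  edgesOfColour : Fin k → List (Fin n × Fin n)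
  edgesOfColour a =
    filter (λ p → (proj₁ p <? proj₂ p) ×-dec MaybeP.≡-dec _≟_ (col (proj₁ p) (proj₂ p)) (just a))
           (cartesianProduct (allFin n) (allFin n))

  τ : Fin k → Permutation′ n
  τ a = foldr (λ p π → transpose (proj₁ p) (proj₂ p) ∘ₚ π) id (edgesOfColour a)

  -- membership in the subgroup 𝔊_κ of S_n generated by τ_1, …, τ_k
  -- (permutations compared extensionally)
  data InColouringGroup : Permutation′ n → Set where
    gen  : ∀ a → InColouringGroup (τ a)
    one  : InColouringGroup id
    mul  : ∀ {π ρ} → InColouringGroup π → InColouringGroup ρ → InColouringGroup (π ∘ₚ ρ)
    inv  : ∀ {π} → InColouringGroup π → InColouringGroup (flip π)
    resp : ∀ {π ρ} → InColouringGroup π → (∀ i → π ⟨$⟩ʳ i ≡ ρ ⟨$⟩ʳ i) → InColouringGroup ρ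

  ColouringGroupIsFull : Set
  ColouringGroupIsFull = ∀ (π : Permutation′ n) → InColouringGroup π

  SameEdge : Fin n × Fin n → Fin n × Fin n → Set
  SameEdge (x , y) (x' , y') = (x ≡ x' × y ≡ y') ⊎ (x ≡ y' × y ≡ x')

  -- the edge {x,y} (written with endpoint x shared) is incident to {u,v}
  -- and different from it
  IncidentTo : Fin n × Fin n → Fin n × Fin n → Set
  IncidentTo (u , v) (x , y) = Adj x y × (x ≡ u ⊎ x ≡ v) × ¬ SameEdge (x , y) (u , v)

  AdjWithout : Subset k → Fin n → Fin n → Set
  AdjWithout S x y = ∃[ a ] (col x y ≡ just a × a ∉ S)

  IsComponentOf : Subset k → Fin n → Subset n → Set
  IsComponentOf S r C = ∀ x → (x ∈ C) ⇔ Star (AdjWithout S) r x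

  ExactlyOneEvenComponent : Subset k → Set
  ExactlyOneEvenComponent S =
    Σ (Fin n) λ r → Σ (Subset n) λ C →
      IsComponentOf S r C × (2 ∣ ∣ C ∣) ×
      (∀ w C' → IsComponentOf S w C' → 2 ∣ ∣ C' ∣ → Star (AdjWithout S) r w)

  IsSymmetricEdge : Fin n → Fin n → Set
  IsSymmetricEdge u v =
    Σ (Fin k) λ c → col u v ≡ just c ×
    (∀ x y x' y' → IncidentTo (u , v) (x , y) → IncidentTo (u , v) (x' , y') →
       col x y ≡ col x' y' → SameEdge (x , y) (x' , y')) ×
    Σ (Subset k) λ S →
      (∀ x y a → IncidentTo (u , v) (x , y) → col x y ≡ just a → a ∈ S) ×
      c ∉ S ×
      ExactlyOneEvenComponent S

  HasSymmetricEdge : Set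
  HasSymmetricEdge = ∃[ u ] ∃[ v ] IsSymmetricEdge u v

-- Let uv be the symmetric edge, S the colour set witnessing this, and σ the product of the
-- τ_a over the colours a ∉ S. The edges with colours outside S form a forest, and a product of the
-- transpositions of a forest, taken in any order, has the components of the forest as its
-- cycles: adding one edge between two components splices their two cycles into one. Every
-- other edge at u or v has its colour in S, so {u, v} is a component, hence the unique even
-- one; thus σ swaps u and v and all its other cycles are odd of length at most n, and σ^N is
-- the transposition (u v) for N = 1·3·5⋯(2n−1).
-- Conjugating (u v) by τ_a, for the colour a of another edge uw, gives (w v), since v meets
-- no edge of colour a. So (u w) lies in the group for every neighbour w of u; conjugating by
-- the τ's along the paths of the tree then yields every transposition (u x), hence S_n.

module Submission where

open import Defs
open import Data.Empty using (⊥; ⊥-elim)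
open import Data.Unit using (⊤; tt)
open import Data.Product using (∃-syntax; _×_; _,_; proj₁; proj₂)
open import Data.Sum using (_⊎_; inj₁; inj₂)
import Data.Sum as Sum
open import Data.Maybe using (just)
import Data.Maybe.Properties as Maybe
open import Data.Nat as ℕ using (ℕ; zero; suc; _+_; _*_; s≤s)
import Data.Nat.Properties as ℕ
open import Data.Nat.Divisibility using (_∣_; divides; ∣-refl; ∣n⇒∣m*n; m∣m*n)
open import Data.Nat.GeneralisedArithmetic using (iterate)
open import Data.Nat.Tactic.RingSolver using (solve-∀)
open import Data.Fin using (Fin; zero; suc; _<_; _<?_)
open import Data.Fin.Properties using (_≟_; <-cmp; <-asym; <-irrefl; any?)
open import Data.Fin.Permutation
  using (Permutation′; transpose; id; flip; _∘ₚ_; _⟨$⟩ʳ_; _⟨$⟩ˡ_; inverseˡ; inverseʳ; _≈_)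
open import Data.Fin.Permutation.Transposition.List using (TranspositionList; eval; decompose; eval-decompose)
open import Data.Fin.Subset as Subset using (Subset; ⁅_⁆; _∪_; ∣_∣; inside; outside)
import Data.Fin.Subset.Properties as Subset
open import Data.Vec using (_∷_)
import Data.Vec as Vec
open import Data.List using (List; []; _∷_; _++_; [_]; length; foldr; concatMap; filter; cartesianProduct; allFin)
open import Data.List.Properties using (++-assoc; ++-identityʳ)
open import Data.List.Membership.Propositional using (_∈_; _∉_)
open import Data.List.Membership.Propositional.Properties
  using (∈-∃++; ∈-++⁺ˡ; ∈-++⁺ʳ; ∈-++⁻; ∈-filter⁻; ∈-filter⁺; ∈-cartesianProduct⁺; ∈-allFin)
open import Data.List.Relation.Unary.All as All using (All; []; _∷_)
open import Data.List.Relation.Unary.AllPairs using ([]; _∷_)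
open import Data.List.Relation.Unary.Any using (here; there)
import Data.List.Relation.Unary.Any as Any
open import Data.List.Relation.Unary.Linked using (Linked; []; [-]; _∷_)
open import Data.List.Relation.Unary.Unique.Propositional using (Unique)
open import Data.List.Relation.Unary.Unique.Propositional.Properties as Unique
  using (cartesianProduct⁺; allFin⁺; Unique[x∷xs]⇒x∉xs)
open import Data.List.Relation.Binary.Disjoint.Propositional using (Disjoint)
open import Data.List.Relation.Binary.Permutation.Propositional as ↭ using (_↭_; ↭-sym; ↭-trans; ↭⇒↭ₛ)
open import Data.List.Relation.Binary.Permutation.Propositional.Properties using (++-comm; shift; ↭-length; ∈-resp-↭)
import Data.List.Relation.Binary.Permutation.Setoid.Properties as ↭ₛ
open import Function.Base using (_∘_)
open import Function.Bundles using (_⇔_; mk⇔; Equivalence)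
open import Function.Construct.Composition using (_⇔-∘_)
open import Relation.Binary using (tri<; tri≈; tri>)
open import Relation.Binary.Definitions using (DecidableEquality)
open import Relation.Binary.Construct.Closure.ReflexiveTransitive using (Star; ε; _◅_; _◅◅_)
import Relation.Binary.Construct.Closure.ReflexiveTransitive as Star
open import Relation.Binary.PropositionalEquality hiding (resp; [_])
open import Relation.Nullary using (¬_; Dec; yes; no)
open import Relation.Nullary.Decidable using (_×-dec_; ¬?)

private
  variable
    n : ℕ

-- Transpositions

module _ (i j : Fin n) where

  transpose-matchˡ : transpose i j ⟨$⟩ʳ i ≡ j
  transpose-matchˡ with i ≟ i
  ... | yes _  = refl
  ... | no i≢i = ⊥-elim (i≢i refl)

  transpose-matchʳ : transpose i j ⟨$⟩ʳ j ≡ i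
  transpose-matchʳ with j ≟ i
  ... | yes j≡i = j≡i
  ... | no _ with j ≟ j
  ...   | yes _  = refl
  ...   | no j≢j = ⊥-elim (j≢j refl)

  transpose-mismatch : ∀ {k} → k ≢ i → k ≢ j → transpose i j ⟨$⟩ʳ k ≡ k
  transpose-mismatch {k} k≢i k≢j with k ≟ i
  ... | yes k≡i = ⊥-elim (k≢i k≡i)
  ... | no _ with k ≟ j
  ...   | yes k≡j = ⊥-elim (k≢j k≡j)
  ...   | no _    = refl

transpose-comm : (i j : Fin n) → transpose i j ≈ transpose j i
transpose-comm i j k = by-cases (k ≟ i) (k ≟ j)
  where
  by-cases : Dec (k ≡ i) → Dec (k ≡ j) → transpose i j ⟨$⟩ʳ k ≡ transpose j i ⟨$⟩ʳ k
  by-cases (yes refl) (yes refl) = refl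
  by-cases (yes refl) (no _)     = trans (transpose-matchˡ k j) (sym (transpose-matchʳ j k))
  by-cases (no _)     (yes refl) = trans (transpose-matchʳ i k) (sym (transpose-matchˡ k i))
  by-cases (no k≢i)   (no k≢j)   =
    trans (transpose-mismatch i j k≢i k≢j) (sym (transpose-mismatch j i k≢j k≢i))

transpose-diag : (i : Fin n) → transpose i i ≈ id
transpose-diag i k = by-cases (k ≟ i)
  where
  by-cases : Dec (k ≡ i) → transpose i i ⟨$⟩ʳ k ≡ k
  by-cases (yes refl) = transpose-matchˡ k k
  by-cases (no k≢i)   = transpose-mismatch i i k≢i k≢i

permutation-injective : (g : Permutation′ n) {x y : Fin n} → g ⟨$⟩ʳ x ≡ g ⟨$⟩ʳ y → x ≡ y
permutation-injective g {x} {y} gx≡gy = begin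
  x                  ≡⟨ inverseˡ g ⟨
  g ⟨$⟩ˡ (g ⟨$⟩ʳ x) ≡⟨ cong (g ⟨$⟩ˡ_) gx≡gy ⟩
  g ⟨$⟩ˡ (g ⟨$⟩ʳ y) ≡⟨ inverseˡ g ⟩
  y                  ∎
  where open ≡-Reasoning

transpose-relabel : (g : Permutation′ n) (i j k : Fin n) →
  g ⟨$⟩ʳ (transpose i j ⟨$⟩ʳ k) ≡ transpose (g ⟨$⟩ʳ i) (g ⟨$⟩ʳ j) ⟨$⟩ʳ (g ⟨$⟩ʳ k)
transpose-relabel g i j k = by-cases (k ≟ i) (k ≟ j)
  where
  g≢ : ∀ {x y} → x ≢ y → g ⟨$⟩ʳ x ≢ g ⟨$⟩ʳ y
  g≢ x≢y gx≡gy = x≢y (permutation-injective g gx≡gy)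
  by-cases : Dec (k ≡ i) → Dec (k ≡ j) →
    g ⟨$⟩ʳ (transpose i j ⟨$⟩ʳ k) ≡ transpose (g ⟨$⟩ʳ i) (g ⟨$⟩ʳ j) ⟨$⟩ʳ (g ⟨$⟩ʳ k)
  by-cases (yes refl) _          =
    trans (cong (g ⟨$⟩ʳ_) (transpose-matchˡ k j)) (sym (transpose-matchˡ (g ⟨$⟩ʳ k) (g ⟨$⟩ʳ j)))
  by-cases (no _)     (yes refl) =
    trans (cong (g ⟨$⟩ʳ_) (transpose-matchʳ i k)) (sym (transpose-matchʳ (g ⟨$⟩ʳ i) (g ⟨$⟩ʳ k)))
  by-cases (no k≢i)   (no k≢j)   = trans (cong (g ⟨$⟩ʳ_) (transpose-mismatch i j k≢i k≢j))
                                        (sym (transpose-mismatch _ _ (g≢ k≢i) (g≢ k≢j)))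

transpose-conjugate : (g : Permutation′ n) (i j : Fin n) →
  (flip g ∘ₚ transpose i j) ∘ₚ g ≈ transpose (g ⟨$⟩ʳ i) (g ⟨$⟩ʳ j)
transpose-conjugate g i j k =
  trans (transpose-relabel g i j (g ⟨$⟩ˡ k)) (cong (transpose _ _ ⟨$⟩ʳ_) (inverseʳ g))

_^ₚ_ : Permutation′ n → ℕ → Permutation′ n
π ^ₚ zero  = id
π ^ₚ suc m = π ∘ₚ π ^ₚ m

^ₚ-iterate : ∀ (π : Permutation′ n) m x → π ^ₚ m ⟨$⟩ʳ x ≡ iterate (π ⟨$⟩ʳ_) x m
^ₚ-iterate π zero    x = refl
^ₚ-iterate π (suc m) x = ^ₚ-iterate π m (π ⟨$⟩ʳ x)

^ₚ-cong : ∀ {π π′ : Permutation′ n} → π ≈ π′ → ∀ m → π ^ₚ m ≈ π′ ^ₚ m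
^ₚ-cong π≈π′ zero    i = refl
^ₚ-cong {π = π} {π′} π≈π′ (suc m) i = trans (^ₚ-cong π≈π′ m (π ⟨$⟩ʳ i)) (cong (π′ ^ₚ m ⟨$⟩ʳ_) (π≈π′ i))

eval-++ : (ps qs : TranspositionList n) → eval (ps ++ qs) ≈ eval ps ∘ₚ eval qs
eval-++ []       qs x = refl
eval-++ (_ ∷ ps) qs x = eval-++ ps qs _

Touches : Fin n → Fin n × Fin n → Set
Touches x (i , j) = x ≡ i ⊎ x ≡ j

eval-fix : (ps : TranspositionList n) {x : Fin n} →
           (∀ {p} → p ∈ ps → ¬ Touches x p) → eval ps ⟨$⟩ʳ x ≡ x
eval-fix []             untouched = refl
eval-fix ((i , j) ∷ ps) {x} untouched = begin
  eval ps ⟨$⟩ʳ (transpose i j ⟨$⟩ʳ x) ≡⟨ cong (eval ps ⟨$⟩ʳ_) (transpose-mismatch i j (untouched (here refl) ∘ inj₁)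
                                                                                    (untouched (here refl) ∘ inj₂)) ⟩
  eval ps ⟨$⟩ʳ x                      ≡⟨ eval-fix ps (untouched ∘ there) ⟩
  x                                   ∎
  where open ≡-Reasoning

eval-swaps : (ps : TranspositionList n) {i j : Fin n} → Unique ps → (i , j) ∈ ps →
             (∀ {p} → p ∈ ps → Touches i p ⊎ Touches j p → p ≡ (i , j)) →
             eval ps ⟨$⟩ʳ i ≡ j × eval ps ⟨$⟩ʳ j ≡ i
eval-swaps (_ ∷ ps) {i} {j} (ij∉ps ∷ _) (here refl) only-ij =
    trans (cong (eval ps ⟨$⟩ʳ_) (transpose-matchˡ i j)) (eval-fix ps (λ p∈ → ∉ps p∈ ∘ inj₂))
  , trans (cong (eval ps ⟨$⟩ʳ_) (transpose-matchʳ i j)) (eval-fix ps (λ p∈ → ∉ps p∈ ∘ inj₁))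
  where
  ∉ps : ∀ {p} → p ∈ ps → ¬ (Touches i p ⊎ Touches j p)
  ∉ps p∈ touch with only-ij (there p∈) touch
  ... | refl = All.lookup ij∉ps p∈ refl
eval-swaps ((a , b) ∷ ps) {i} {j} (ab∉ps ∷ unique) (there ij∈) only-ij
  with eval-swaps ps unique ij∈ (only-ij ∘ there)
... | ij , ji = trans (cong (eval ps ⟨$⟩ʳ_) (fixes (inj₁ refl))) ij
              , trans (cong (eval ps ⟨$⟩ʳ_) (fixes (inj₂ refl))) ji
  where
  ab≢ij : (a , b) ≢ (i , j)
  ab≢ij = All.lookup ab∉ps ij∈
  touching : ∀ {x} → x ≡ i ⊎ x ≡ j → Touches x (a , b) → Touches i (a , b) ⊎ Touches j (a , b)
  touching (inj₁ refl) = inj₁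
  touching (inj₂ refl) = inj₂
  fixes : ∀ {x} → x ≡ i ⊎ x ≡ j → transpose a b ⟨$⟩ʳ x ≡ x
  fixes x∈ij = transpose-mismatch a b (ab≢ij ∘ only-ij (here refl) ∘ touching x∈ij ∘ inj₁)
                                      (ab≢ij ∘ only-ij (here refl) ∘ touching x∈ij ∘ inj₂)

-- Iterates and odd products

even-or-odd : ∀ m → 2 ∣ m ⊎ ∃[ j ] m ≡ suc (2 * j)
even-or-odd zero    = inj₁ (divides 0 refl)
even-or-odd (suc m) with even-or-odd m
... | inj₁ (divides j refl) = inj₂ (j , cong suc (ℕ.*-comm j 2))
... | inj₂ (j , refl)       = inj₁ (divides (suc j) (lemma j))
  where
  lemma : ∀ j → suc (suc (2 * j)) ≡ suc j * 2
  lemma = solve-∀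

oddProduct : ℕ → ℕ
oddProduct zero    = 1
oddProduct (suc m) = suc (2 * m) * oddProduct m

odd∣oddProduct : ∀ {m j} → j ℕ.< m → suc (2 * j) ∣ oddProduct m
odd∣oddProduct {suc m} {j} (s≤s j≤m) with ℕ.m≤n⇒m<n∨m≡n j≤m
... | inj₁ j<m  = ∣n⇒∣m*n (suc (2 * m)) (odd∣oddProduct j<m)
... | inj₂ refl = m∣m*n (oddProduct j)

oddProduct-odd : ∀ m → ∃[ h ] oddProduct m ≡ suc (2 * h)
oddProduct-odd zero    = 0 , refl
oddProduct-odd (suc m) with oddProduct-odd m
... | h , eq = m + h + 2 * m * h , trans (cong (suc (2 * m) *_) eq) (lemma m h)
  where
  lemma : ∀ a b → suc (2 * a) * suc (2 * b) ≡ suc (2 * (a + b + 2 * a * b))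
  lemma = solve-∀

module _ {A : Set} where

  iterate-+ : ∀ (f : A → A) x m l → iterate f x (m + l) ≡ iterate f (iterate f x m) l
  iterate-+ f x zero    l = refl
  iterate-+ f x (suc m) l = iterate-+ f (f x) m l

  iterate-periodic : ∀ (f : A → A) {x m} → iterate f x m ≡ x → ∀ q → iterate f x (q * m) ≡ x
  iterate-periodic f         period zero    = refl
  iterate-periodic f {x} {m} period (suc q) =
    trans (iterate-+ f x m (q * m)) (trans (cong (λ y → iterate f y (q * m)) period) (iterate-periodic f period q))

module _ {A : Set} (f : A → A) where

  iterate-oddProduct-fix : ∀ {x} j {m} → suc (2 * j) ℕ.≤ m → iterate f x (suc (2 * j)) ≡ x →
                           iterate f x (oddProduct m) ≡ x
  iterate-oddProduct-fix {x} j {m} 2j+1≤m period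
    with odd∣oddProduct {m} {j} (ℕ.≤-trans (s≤s (ℕ.m≤m+n j (j + 0))) 2j+1≤m)
  ... | divides q eq = subst (λ l → iterate f x l ≡ x) (sym eq) (iterate-periodic f period q)

  iterate-oddProduct-swap : ∀ {x y} m → f x ≡ y → f y ≡ x → iterate f x (oddProduct m) ≡ y
  iterate-oddProduct-swap {x} {y} m fx fy with oddProduct-odd m
  ... | h , eq = begin
    iterate f x (oddProduct m) ≡⟨ cong (iterate f x) eq ⟩
    iterate f (f x) (2 * h)    ≡⟨ cong₂ (iterate f) fx (ℕ.*-comm 2 h) ⟩
    iterate f y (h * 2)        ≡⟨ iterate-periodic f (trans (cong f fy) fx) h ⟩
    y                          ∎
    where open ≡-Reasoning

power-is-transposition : ∀ (π : Permutation′ n) {u v} → π ⟨$⟩ʳ u ≡ v → π ⟨$⟩ʳ v ≡ u →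
  (∀ {x} → x ≢ u → x ≢ v → ∃[ j ] suc (2 * j) ℕ.≤ n × iterate (π ⟨$⟩ʳ_) x (suc (2 * j)) ≡ x) →
  π ^ₚ oddProduct n ≈ transpose u v
power-is-transposition {n} π {u} {v} πu πv odd-orbits i =
  trans (^ₚ-iterate π (oddProduct n) i) (by-cases (i ≟ u) (i ≟ v))
  where
  by-cases : Dec (i ≡ u) → Dec (i ≡ v) → iterate (π ⟨$⟩ʳ_) i (oddProduct n) ≡ transpose u v ⟨$⟩ʳ i
  by-cases (yes refl) _          = trans (iterate-oddProduct-swap _ n πu πv) (sym (transpose-matchˡ u v))
  by-cases (no _)     (yes refl) = trans (iterate-oddProduct-swap _ n πv πu) (sym (transpose-matchʳ u v))
  by-cases (no i≢u)   (no i≢v)   with odd-orbits i≢u i≢v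
  ... | j , 2j+1≤n , period = trans (iterate-oddProduct-fix _ j 2j+1≤n period) (sym (transpose-mismatch u v i≢u i≢v))

-- Cycles of a function

module _ {A : Set} where

  unique-resp-↭ : {xs ys : List A} → xs ↭ ys → Unique xs → Unique ys
  unique-resp-↭ xs↭ys = ↭ₛ.Unique-resp-↭ (setoid A) (↭⇒↭ₛ xs↭ys)

  linked-join : ∀ {R : A → A → Set} xs {z ys} → Linked R (xs ++ [ z ]) → Linked R (z ∷ ys) → Linked R (xs ++ z ∷ ys)
  linked-join []             _             zys = zys
  linked-join (_ ∷ [])       (r ∷ _)       zys = r ∷ zys
  linked-join (_ ∷ x ∷ xs)   (r ∷ xs++z)   zys = r ∷ linked-join (x ∷ xs) xs++z zys

  IsCycleOf : (A → A) → List A → Set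
  IsCycleOf ρ []       = ⊥
  IsCycleOf ρ (x ∷ xs) = Unique (x ∷ xs) × Linked (λ a b → ρ a ≡ b) (x ∷ xs ++ [ x ])

  module _ {ρ : A → A} where

    cycle-rotate₁ : ∀ x xs → IsCycleOf ρ (x ∷ xs) → IsCycleOf ρ (xs ++ [ x ])
    cycle-rotate₁ x []       cyc                 = cyc
    cycle-rotate₁ x (y ∷ xs) (unique , ρx ∷ chain) =
        unique-resp-↭ (++-comm [ x ] (y ∷ xs)) unique
      , subst (Linked _) (sym (++-assoc (y ∷ xs) [ x ] [ y ])) (linked-join (y ∷ xs) chain (ρx ∷ [-]))

    cycle-rotate : ∀ xs ys → IsCycleOf ρ (xs ++ ys) → IsCycleOf ρ (ys ++ xs)
    cycle-rotate []       ys cyc = subst (IsCycleOf ρ) (sym (++-identityʳ ys)) cyc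
    cycle-rotate (x ∷ xs) ys cyc =
      subst (IsCycleOf ρ) (++-assoc ys [ x ] xs)
        (cycle-rotate xs (ys ++ [ x ]) (subst (IsCycleOf ρ) (++-assoc xs ys [ x ]) (cycle-rotate₁ x (xs ++ ys) cyc)))

    cycle-from : ∀ {l x} → IsCycleOf ρ l → x ∈ l → ∃[ xs ] IsCycleOf ρ (x ∷ xs) × (x ∷ xs) ↭ l
    cycle-from cyc x∈l with ∈-∃++ x∈l
    ... | xs , ys , refl = ys ++ xs , cycle-rotate xs (_ ∷ ys) cyc , ++-comm (_ ∷ ys) xs

    cycle-period : ∀ {l x} → IsCycleOf ρ l → x ∈ l → iterate ρ x (length l) ≡ x
    cycle-period {l} {x} cyc x∈l with cycle-from cyc x∈l
    ... | xs , (_ , chain) , x∷xs↭l = subst (λ m → iterate ρ x m ≡ x) (↭-length x∷xs↭l) (iterate-chain xs chain)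
      where
      iterate-chain : ∀ {a b} ys → Linked (λ a b → ρ a ≡ b) (a ∷ ys ++ [ b ]) → iterate ρ a (suc (length ys)) ≡ b
      iterate-chain []       (ρa ∷ [-])   = ρa
      iterate-chain (y ∷ ys) (refl ∷ chain) = iterate-chain ys chain

    two-cycle-successor : ∀ {l x z} → IsCycleOf ρ l → x ∈ l → z ∈ l → x ≢ z →
                          (∀ {y} → y ∈ l → y ≡ x ⊎ y ≡ z) → ρ x ≡ z
    two-cycle-successor cyc x∈l z∈l x≢z x-or-z with cycle-from cyc x∈l
    ... | [] , _ , x↭l with ∈-resp-↭ (↭-sym x↭l) z∈l
    ...   | here z≡x = ⊥-elim (x≢z (sym z≡x))
    two-cycle-successor cyc x∈l z∈l x≢z x-or-z | w ∷ _ , (unique , ρx ∷ _) , x∷xs↭l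
      with x-or-z (∈-resp-↭ x∷xs↭l (there (here refl)))
    ... | inj₁ refl = ⊥-elim (Unique[x∷xs]⇒x∉xs unique (here refl))
    ... | inj₂ refl = ρx

  merge-↭ : ∀ (a : A) as b bs → (a ∷ as) ++ (b ∷ bs) ↭ a ∷ bs ++ b ∷ as
  merge-↭ a as b bs = ↭.prep a (↭-trans (++-comm as (b ∷ bs)) (↭-sym (shift b bs as)))

  module _ {ρ ρ′ : A → A} where

    private
      Agree : A → Set
      Agree y = ρ′ y ≡ ρ y

    linked-transfer : ∀ {x x′ z} ys → Linked (λ a b → ρ a ≡ b) (x ∷ ys ++ [ z ]) → ρ′ x′ ≡ ρ x → All Agree ys →
                      Linked (λ a b → ρ′ a ≡ b) (x′ ∷ ys ++ [ z ])
    linked-transfer []       (ρx ∷ [-])   ρ′x′≡ρx []           = trans ρ′x′≡ρx ρx ∷ [-]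
    linked-transfer (y ∷ ys) (ρx ∷ chain) ρ′x′≡ρx (ρ′y≡ρy ∷ agree) =
      trans ρ′x′≡ρx ρx ∷ linked-transfer ys chain ρ′y≡ρy agree

    cycle-transfer : ∀ {l} → IsCycleOf ρ l → All Agree l → IsCycleOf ρ′ l
    cycle-transfer {x ∷ xs} (unique , chain) (ρ′x≡ρx ∷ agree) = unique , linked-transfer xs chain ρ′x≡ρx agree

    cycle-merge : ∀ {a as b bs} → ρ′ a ≡ ρ b → ρ′ b ≡ ρ a → (∀ {y} → y ≢ a → y ≢ b → Agree y) →
                  IsCycleOf ρ (a ∷ as) → IsCycleOf ρ (b ∷ bs) → Disjoint (a ∷ as) (b ∷ bs) →
                  IsCycleOf ρ′ (a ∷ bs ++ b ∷ as)
    cycle-merge {a} {as} {b} {bs} ρ′a ρ′b agree (unique-a , chain-a) (unique-b , chain-b) disjoint =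
        unique-resp-↭ (merge-↭ a as b bs) (Unique.++⁺ unique-a unique-b disjoint)
      , subst (Linked _ ∘ (a ∷_)) (sym (++-assoc bs (b ∷ as) [ a ]))
          (linked-join (a ∷ bs) (linked-transfer bs chain-b ρ′a agree-bs) (linked-transfer as chain-a ρ′b agree-as))
      where
      agree-as : All Agree as
      agree-as = All.tabulate λ y∈as →
        agree (λ { refl → Unique[x∷xs]⇒x∉xs unique-a y∈as }) (λ { refl → disjoint (there y∈as , here refl) })
      agree-bs : All Agree bs
      agree-bs = All.tabulate λ y∈bs →
        agree (λ { refl → disjoint (here refl , there y∈bs) }) (λ { refl → Unique[x∷xs]⇒x∉xs unique-b y∈bs })

-- Forests of transpositions

module _ {A : Set} (_≟ₐ_ : DecidableEquality A) {R : A → A → Set} where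

  data SimplePath : A → A → List A → Set where
    end  : ∀ {b} → SimplePath b b [ b ]
    step : ∀ {a w b l} → R a w → SimplePath w b l → a ∉ l → SimplePath a b (a ∷ l)

  simplePath-suffix : ∀ {a w b l} → SimplePath w b l → a ∈ l → ∃[ l′ ] SimplePath a b l′
  simplePath-suffix end             (here refl) = _ , end
  simplePath-suffix (step r p a∉)   (here refl) = _ , step r p a∉
  simplePath-suffix (step _ p _)    (there a∈)  = simplePath-suffix p a∈

  star⇒simplePath : ∀ {a b} → Star R a b → ∃[ l ] SimplePath a b l
  star⇒simplePath ε = _ , end
  star⇒simplePath {a} (r ◅ rs) with star⇒simplePath rs
  ... | l , p with Any.any? (a ≟ₐ_) l
  ...   | yes a∈ = simplePath-suffix p a∈
  ...   | no a∉  = a ∷ l , step r p a∉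

  simplePath-unique : ∀ {a b l} → SimplePath a b l → Unique l
  simplePath-unique end          = [] ∷ []
  simplePath-unique (step _ p a∉) =
    All.tabulate (λ x∈ a≡x → a∉ (subst (_∈ _) (sym a≡x) x∈)) ∷ simplePath-unique p

  simplePath-linked : ∀ {Q : A → A → Set} → (∀ {x y} → R x y → Q x y) →
                      ∀ {a b l z} → SimplePath a b l → Q b z → Linked Q (l ++ [ z ])
  simplePath-linked f end                   q = q ∷ [-]
  simplePath-linked f (step r end _)        q = f r ∷ q ∷ [-]
  simplePath-linked f (step r p@(step _ _ _) _) q = f r ∷ simplePath-linked f p q

module _ {n : ℕ} where

  Joins : TranspositionList n → Fin n → Fin n → Set
  Joins ps x y = (x , y) ∈ ps ⊎ (y , x) ∈ ps

  joins-sym : ∀ {ps x y} → Joins ps x y → Joins ps y x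
  joins-sym (inj₁ xy∈) = inj₂ xy∈
  joins-sym (inj₂ yx∈) = inj₁ yx∈

  Connects : TranspositionList n → Fin n → Fin n → Set
  Connects ps = Star (Joins ps)

  connects-sym : ∀ {ps x y} → Connects ps x y → Connects ps y x
  connects-sym = Star.reverse joins-sym

  IsForest : TranspositionList n → Set
  IsForest []             = ⊤
  IsForest ((a , b) ∷ ps) = ¬ Connects ps a b × IsForest ps

  record OrbitIsComponent (ps : TranspositionList n) (x : Fin n) : Set where
    field
      others    : List (Fin n)
      is-cycle  : IsCycleOf (eval ps ⟨$⟩ʳ_) (x ∷ others)
      component : ∀ y → y ∈ x ∷ others ⇔ Connects ps x y

    orbit : List (Fin n)
    orbit = x ∷ others

    orbit-unique : Unique orbit
    orbit-unique = proj₁ is-cycle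

    orbit⁺ : ∀ {y} → Connects ps x y → y ∈ orbit
    orbit⁺ = Equivalence.from (component _)

    orbit⁻ : ∀ {y} → y ∈ orbit → Connects ps x y
    orbit⁻ = Equivalence.to (component _)

  open OrbitIsComponent

  orbit-reroot : ∀ {ps x y} → Connects ps x y → OrbitIsComponent ps y → OrbitIsComponent ps x
  orbit-reroot {ps} {x} {y} x⇝y O with cycle-from (is-cycle O) (orbit⁺ O (connects-sym x⇝y))
  ... | xs , cyc , x∷xs↭ = record
    { others    = xs
    ; is-cycle  = cyc
    ; component = λ z → mk⇔ (λ z∈ → x⇝y ◅◅ orbit⁻ O (∈-resp-↭ x∷xs↭ z∈))
                            (λ x⇝z → ∈-resp-↭ (↭-sym x∷xs↭) (orbit⁺ O (connects-sym x⇝y ◅◅ x⇝z)))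
    }

  orbits-[] : ∀ x → OrbitIsComponent [] x
  orbits-[] x = record
    { others    = []
    ; is-cycle  = [] ∷ [] , refl ∷ [-]
    ; component = λ y → mk⇔ (λ { (here refl) → ε }) (λ x⇝y → here (sym (unconnected x⇝y)))
    }
    where
    unconnected : ∀ {y} → Connects [] x y → x ≡ y
    unconnected ε               = refl
    unconnected (inj₁ () ◅ _)
    unconnected (inj₂ () ◅ _)

  module _ {a b : Fin n} {ps : TranspositionList n} where

    private
      ps′ : TranspositionList n
      ps′ = (a , b) ∷ ps

      Near : Fin n → Set
      Near x = Connects ps x a ⊎ Connects ps x b

    connects-there : ∀ {x y} → Connects ps x y → Connects ps′ x y
    connects-there = Star.map (Sum.map there there)

    joins-∷ : ∀ {x y} → Joins ps′ x y → Joins ps x y ⊎ (x ≡ a × y ≡ b ⊎ x ≡ b × y ≡ a)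
    joins-∷ (inj₁ (here refl))  = inj₂ (inj₁ (refl , refl))
    joins-∷ (inj₁ (there xy∈)) = inj₁ (inj₁ xy∈)
    joins-∷ (inj₂ (here refl))  = inj₂ (inj₂ (refl , refl))
    joins-∷ (inj₂ (there yx∈)) = inj₁ (inj₂ yx∈)

    connects-∷ : ∀ {x y} → Connects ps′ x y → Connects ps x y ⊎ (Near x × Near y)
    connects-∷ ε = inj₁ ε
    connects-∷ (e ◅ w⇝y) with joins-∷ e | connects-∷ w⇝y
    ... | inj₁ e′                     | inj₁ w⇝′y          = inj₁ (e′ ◅ w⇝′y)
    ... | inj₁ e′                     | inj₂ (near-w , near-y) = inj₂ (Sum.map (e′ ◅_) (e′ ◅_) near-w , near-y)
    ... | inj₂ (inj₁ (refl , refl)) | inj₁ b⇝y          = inj₂ (inj₁ ε , inj₂ (connects-sym b⇝y))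
    ... | inj₂ (inj₂ (refl , refl)) | inj₁ a⇝y          = inj₂ (inj₂ ε , inj₁ (connects-sym a⇝y))
    ... | inj₂ (inj₁ (refl , refl)) | inj₂ (_ , near-y)  = inj₂ (inj₁ ε , near-y)
    ... | inj₂ (inj₂ (refl , refl)) | inj₂ (_ , near-y)  = inj₂ (inj₂ ε , near-y)

    module _ (a↮b : ¬ Connects ps a b) (orbits : ∀ x → OrbitIsComponent ps x) where

      private
        ρ : Fin n → Fin n
        ρ = eval ps ⟨$⟩ʳ_

        Oa Ob : OrbitIsComponent ps _
        Oa = orbits a
        Ob = orbits b

        disjoint : Disjoint (orbit Oa) (orbit Ob)
        disjoint (y∈a , y∈b) = a↮b (orbit⁻ Oa y∈a ◅◅ connects-sym (orbit⁻ Ob y∈b))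

      merged-orbit : OrbitIsComponent ps′ a
      merged-orbit = record
        { others    = others Ob ++ b ∷ others Oa
        ; is-cycle  = cycle-merge (cong ρ (transpose-matchˡ a b)) (cong ρ (transpose-matchʳ a b))
                        (λ y≢a y≢b → cong ρ (transpose-mismatch a b y≢a y≢b)) (is-cycle Oa) (is-cycle Ob) disjoint
        ; component = λ y → mk⇔ (to ∘ ∈-++⁻ (orbit Oa) ∘ ∈-resp-↭ (↭-sym merged↭))
                                 (∈-resp-↭ merged↭ ∘ from ∘ connects-∷)
        }
        where
        merged↭ : orbit Oa ++ orbit Ob ↭ a ∷ others Ob ++ b ∷ others Oa
        merged↭ = merge-↭ a (others Oa) b (others Ob)
        to : ∀ {y} → y ∈ orbit Oa ⊎ y ∈ orbit Ob → Connects ps′ a y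
        to (inj₁ y∈a) = connects-there (orbit⁻ Oa y∈a)
        to (inj₂ y∈b) = inj₁ (here refl) ◅ connects-there (orbit⁻ Ob y∈b)
        from : ∀ {y} → Connects ps a y ⊎ (Near a × Near y) → y ∈ orbit Oa ++ orbit Ob
        from (inj₁ a⇝y)                = ∈-++⁺ˡ (orbit⁺ Oa a⇝y)
        from (inj₂ (_ , inj₁ y⇝a)) = ∈-++⁺ˡ (orbit⁺ Oa (connects-sym y⇝a))
        from (inj₂ (_ , inj₂ y⇝b)) = ∈-++⁺ʳ (orbit Oa) (orbit⁺ Ob (connects-sym y⇝b))

      orbits-∷ : ∀ x → OrbitIsComponent ps′ x
      orbits-∷ x with Any.any? (a ≟_) (orbit (orbits x)) | Any.any? (b ≟_) (orbit (orbits x))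
      ... | yes a∈ | _      = orbit-reroot (connects-there (orbit⁻ (orbits x) a∈)) merged-orbit
      ... | no _   | yes b∈ = orbit-reroot (connects-there (orbit⁻ (orbits x) b∈) ◅◅ inj₂ (here refl) ◅ ε) merged-orbit
      ... | no a∉  | no b∉  = record
        { others    = others Ox
        ; is-cycle  = cycle-transfer (is-cycle Ox) (All.tabulate λ y∈ →
                        cong ρ (transpose-mismatch a b (λ { refl → a∉ y∈ }) (λ { refl → b∉ y∈ })))
        ; component = λ y → mk⇔ (connects-there ∘ orbit⁻ Ox) (from ∘ connects-∷)
        }
        where
        Ox : OrbitIsComponent ps x
        Ox = orbits x
        from : ∀ {y} → Connects ps x y ⊎ (Near x × Near y) → y ∈ orbit Ox
        from (inj₁ x⇝y)                = orbit⁺ Ox x⇝y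
        from (inj₂ (inj₁ x⇝a , _)) = ⊥-elim (a∉ (orbit⁺ Ox x⇝a))
        from (inj₂ (inj₂ x⇝b , _)) = ⊥-elim (b∉ (orbit⁺ Ox x⇝b))

  forest-orbits : ∀ {ps} → IsForest ps → ∀ x → OrbitIsComponent ps x
  forest-orbits {[]}           _                 = orbits-[]
  forest-orbits {(a , b) ∷ ps} (a↮b , forest) = orbits-∷ a↮b (forest-orbits forest)

-- Subsets of Fin n given by lists

fromList : List (Fin n) → Subset n
fromList = foldr (λ y p → ⁅ y ⁆ ∪ p) Subset.⊥

∣⁅x⁆∪p∣ : ∀ (x : Fin n) p → x Subset.∉ p → ∣ ⁅ x ⁆ ∪ p ∣ ≡ suc ∣ p ∣
∣⁅x⁆∪p∣ zero    (inside  ∷ p) x∉p = ⊥-elim (x∉p Vec.here)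
∣⁅x⁆∪p∣ zero    (outside ∷ p) _   = cong (suc ∘ ∣_∣) (Subset.∪-identityˡ p)
∣⁅x⁆∪p∣ (suc x) (inside  ∷ p) x∉p = cong suc (∣⁅x⁆∪p∣ x p (x∉p ∘ Vec.there))
∣⁅x⁆∪p∣ (suc x) (outside ∷ p) x∉p = ∣⁅x⁆∪p∣ x p (x∉p ∘ Vec.there)

∈fromList⇔ : ∀ {x : Fin n} l → x Subset.∈ fromList l ⇔ x ∈ l
∈fromList⇔ l = mk⇔ (to l) (from l)
  where
  to : ∀ {x} l → x Subset.∈ fromList l → x ∈ l
  to []      x∈ = ⊥-elim (Subset.∉⊥ x∈)
  to (y ∷ l) x∈ = Sum.[ here ∘ Subset.x∈⁅y⁆⇒x≡y y , there ∘ to l ] (Subset.x∈p∪q⁻ ⁅ y ⁆ (fromList l) x∈)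
  from : ∀ {x} l → x ∈ l → x Subset.∈ fromList l
  from (y ∷ l) (here refl) = Subset.x∈p∪q⁺ (inj₁ (Subset.x∈⁅x⁆ y))
  from (y ∷ l) (there x∈)  = Subset.x∈p∪q⁺ {p = ⁅ y ⁆} (inj₂ (from l x∈))

∣fromList∣ : ∀ {l : List (Fin n)} → Unique l → ∣ fromList l ∣ ≡ length l
∣fromList∣ {n} {[]}    _              = Subset.∣⊥∣≡0 n
∣fromList∣ {_} {x ∷ l} unique@(_ ∷ unique-l) =
  trans (∣⁅x⁆∪p∣ x (fromList l) (Unique[x∷xs]⇒x∉xs unique ∘ Equivalence.to (∈fromList⇔ l)))
        (cong suc (∣fromList∣ unique-l))

-- The colouring group

IncidentColoursDistinct : {k : ℕ} → Colouring n k → Fin n → Fin n → Set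
IncidentColoursDistinct κ u v =
  ∀ x y x' y' → IncidentTo κ (u , v) (x , y) → IncidentTo κ (u , v) (x' , y') →
  κ x y ≡ κ x' y' → SameEdge κ (x , y) (x' , y')

module _ {n k : ℕ} (κ : Colouring n k) where

  Swappable : Fin n → Fin n → Set
  Swappable i j = InColouringGroup κ (transpose i j)

  swappable-conjugate : ∀ {g i j} → InColouringGroup κ g → Swappable i j →
                        Swappable (g ⟨$⟩ʳ i) (g ⟨$⟩ʳ j)
  swappable-conjugate {g} {i} {j} g∈ ij = resp (mul (mul (inv g∈) ij) g∈) (transpose-conjugate g i j)

  swappable-refl : ∀ i → Swappable i i
  swappable-refl i = resp one (λ k → sym (transpose-diag i k))

  swappable-sym : ∀ {i j} → Swappable i j → Swappable j i
  swappable-sym {i} {j} ij = resp ij (transpose-comm i j)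

  swappable-trans : ∀ {i j l} → Swappable i j → Swappable j l → Swappable i l
  swappable-trans {i} {j} {l} ij jl with i ≟ j | i ≟ l
  ... | yes refl | _        = jl
  ... | no _     | yes refl = swappable-refl i
  ... | no i≢j   | no i≢l   =
    subst₂ Swappable (transpose-mismatch j l i≢j i≢l) (transpose-matchˡ j l) (swappable-conjugate jl ij)

  full-if-all-swappable : (∀ i j → Swappable i j) → ColouringGroupIsFull κ
  full-if-all-swappable swappable π = resp (eval∈ (decompose π)) (eval-decompose π)
    where
    eval∈ : (ps : TranspositionList n) → InColouringGroup κ (eval ps)
    eval∈ []             = one
    eval∈ ((i , j) ∷ ps) = mul (swappable i j) (eval∈ ps)

^ₚ∈ : ∀ {k} {κ : Colouring n k} {π} m → InColouringGroup κ π → InColouringGroup κ (π ^ₚ m)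
^ₚ∈ zero    π∈ = one
^ₚ∈ (suc m) π∈ = mul π∈ (^ₚ∈ m π∈)

module _ {n k : ℕ} (κ : Colouring n k) where

  IsEdgeOfColour : Fin k → Fin n × Fin n → Set
  IsEdgeOfColour a (x , y) = x < y × κ x y ≡ just a

  private
    isEdgeOfColour? : ∀ a p → Dec (IsEdgeOfColour a p)
    isEdgeOfColour? a (x , y) = (x <? y) ×-dec Maybe.≡-dec _≟_ (κ x y) (just a)

  ∈edgesOfColour⁻ : ∀ {a p} → p ∈ edgesOfColour κ a → IsEdgeOfColour a p
  ∈edgesOfColour⁻ {a} = proj₂ ∘ ∈-filter⁻ (isEdgeOfColour? a) {xs = cartesianProduct (allFin n) (allFin n)}

  ∈edgesOfColour⁺ : ∀ {a p} → IsEdgeOfColour a p → p ∈ edgesOfColour κ a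
  ∈edgesOfColour⁺ {a} = ∈-filter⁺ (isEdgeOfColour? a) (∈-cartesianProduct⁺ (∈-allFin _) (∈-allFin _))

  edgesOfColour-unique : ∀ a → Unique (edgesOfColour κ a)
  edgesOfColour-unique a = Unique.filter⁺ (isEdgeOfColour? a) (cartesianProduct⁺ (allFin⁺ n) (allFin⁺ n))

  τ≈eval : ∀ a → τ κ a ≈ eval (edgesOfColour κ a)
  τ≈eval a = foldr≈eval (edgesOfColour κ a)
    where
    foldr≈eval : (ps : TranspositionList n) → foldr (λ p π → transpose (proj₁ p) (proj₂ p) ∘ₚ π) id ps ≈ eval ps
    foldr≈eval []       x = refl
    foldr≈eval (_ ∷ ps) x = foldr≈eval ps _

module _ {n k : ℕ} {κ : Colouring n k} (simple : IsSimpleGraph κ) where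

  colour-sym : ∀ x y → κ x y ≡ κ y x
  colour-sym = proj₁ simple

  loopless : ∀ {x a} → κ x x ≢ just a
  loopless {x} xx with () ← trans (sym (proj₂ simple x)) xx

  adj-sym : ∀ {x y} → Adj κ x y → Adj κ y x
  adj-sym {x} {y} (a , xy) = a , trans (colour-sym y x) xy

  module _ (proper : IsProper κ) where

    only-edge-at : ∀ {a x y} → x < y → κ x y ≡ just a →
                   ∀ {p} → p ∈ edgesOfColour κ a → Touches x p ⊎ Touches y p → p ≡ (x , y)
    only-edge-at {a} {x} {y} x<y xy {p₁ , p₂} p∈ touch with ∈edgesOfColour⁻ κ p∈ | touch
    ... | _     , xp₂ | inj₁ (inj₁ refl) = cong (x ,_) (proper x p₂ y a xp₂ xy)
    ... | p₁<x  , p₁x | inj₁ (inj₂ refl) =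
      ⊥-elim (<-asym x<y (subst (_< x) (proper x p₁ y a (trans (colour-sym x p₁) p₁x) xy) p₁<x))
    ... | y<p₂  , yp₂ | inj₂ (inj₁ refl) =
      ⊥-elim (<-asym x<y (subst (y <_) (proper y p₂ x a yp₂ (trans (colour-sym y x) xy)) y<p₂))
    ... | _     , p₁y | inj₂ (inj₂ refl) =
      cong (_, y) (proper y p₁ x a (trans (colour-sym y p₁) p₁y) (trans (colour-sym y x) xy))

    τ-swaps-ordered : ∀ {a x y} → x < y → κ x y ≡ just a → τ κ a ⟨$⟩ʳ x ≡ y × τ κ a ⟨$⟩ʳ y ≡ x
    τ-swaps-ordered {a} {x} {y} x<y xy
      with eval-swaps _ (edgesOfColour-unique κ a) (∈edgesOfColour⁺ κ (x<y , xy)) (only-edge-at x<y xy)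
    ... | x↦y , y↦x = trans (τ≈eval κ a x) x↦y , trans (τ≈eval κ a y) y↦x

    τ-moves : ∀ {a x y} → κ x y ≡ just a → τ κ a ⟨$⟩ʳ x ≡ y
    τ-moves {a} {x} {y} xy with <-cmp x y
    ... | tri< x<y _ _  = proj₁ (τ-swaps-ordered x<y xy)
    ... | tri≈ _ refl _ = ⊥-elim (loopless xy)
    ... | tri> _ _ y<x  = proj₂ (τ-swaps-ordered y<x (trans (colour-sym y x) xy))

    τ-fixes : ∀ {a x} → (∀ y → κ x y ≢ just a) → τ κ a ⟨$⟩ʳ x ≡ x
    τ-fixes {a} {x} no-edge = trans (τ≈eval κ a x) (eval-fix _ untouched)
      where
      untouched : ∀ {p} → p ∈ edgesOfColour κ a → ¬ Touches x p
      untouched {p₁ , p₂} p∈ (inj₁ refl) = no-edge p₂ (proj₂ (∈edgesOfColour⁻ κ p∈))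
      untouched {p₁ , p₂} p∈ (inj₂ refl) = no-edge p₁ (trans (colour-sym x p₁) (proj₂ (∈edgesOfColour⁻ κ p∈)))

    module _ {u v : Fin n} {c : Fin k} (uv : κ u v ≡ just c) (distinct : IncidentColoursDistinct κ u v) where

      private
        u≢v : u ≢ v
        u≢v refl = loopless uv

      colour-at-u-absent-at-v : ∀ {a w} → κ u w ≡ just a → w ≢ v → ∀ y → κ v y ≢ just a
      colour-at-u-absent-at-v {a} {w} uw w≢v y vy with y ≟ u
      ... | yes refl = w≢v (proper u w v a uw (trans (colour-sym u v) vy))
      ... | no y≢u with distinct u w v y ((a , uw) , inj₁ refl , uw≢uv) ((a , vy) , inj₂ refl , vy≢uv) (trans uw (sym vy))
        where
        uw≢uv : ¬ SameEdge κ (u , w) (u , v)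
        uw≢uv (inj₁ (_ , w≡v)) = w≢v w≡v
        uw≢uv (inj₂ (u≡v , _)) = u≢v u≡v
        vy≢uv : ¬ SameEdge κ (v , y) (u , v)
        vy≢uv (inj₁ (v≡u , _)) = u≢v (sym v≡u)
        vy≢uv (inj₂ (_ , y≡u)) = y≢u y≡u
      ... | inj₁ (u≡v , _) = u≢v u≡v
      ... | inj₂ (_ , w≡v) = w≢v w≡v

      module _ (swap-uv : Swappable κ u v) where

        swappable-neighbour : ∀ {a w} → κ u w ≡ just a → Swappable κ u w
        swappable-neighbour {a} {w} uw with w ≟ v
        ... | yes refl = swap-uv
        ... | no w≢v   = swappable-trans κ swap-uv (swappable-sym κ swap-wv)
          where
          swap-wv : Swappable κ w v
          swap-wv = subst₂ (Swappable κ) (τ-moves uw) (τ-fixes (colour-at-u-absent-at-v uw w≢v))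
                           (swappable-conjugate κ (gen a) swap-uv)

        swappable-τ-image : ∀ a → Swappable κ u (τ κ a ⟨$⟩ʳ u)
        swappable-τ-image a with any? (λ y → Maybe.≡-dec _≟_ (κ u y) (just a))
        ... | yes (w , uw) = subst (Swappable κ u) (sym (τ-moves uw)) (swappable-neighbour uw)
        ... | no ∄w        = subst (Swappable κ u) (sym (τ-fixes (λ y uy → ∄w (y , uy)))) (swappable-refl κ u)

        swappable-along-walk : ∀ {x z} → Star (Adj κ) x z → Swappable κ u x → Swappable κ u z
        swappable-along-walk ε                      swap-ux = swap-ux
        swappable-along-walk ((a , xy) ◅ walk) swap-ux =
          swappable-along-walk walk
            (swappable-trans κ (swappable-τ-image a)
              (subst (Swappable κ _) (τ-moves xy) (swappable-conjugate κ (gen a) swap-ux)))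

        full-if-swappable-edge : Connected κ → ColouringGroupIsFull κ
        full-if-swappable-edge connected = full-if-all-swappable κ λ i j →
          swappable-trans κ (swappable-sym κ (from-u i)) (from-u j)
          where
          from-u : ∀ x → Swappable κ u x
          from-u x = swappable-along-walk (connected u x) (swappable-refl κ u)

module _ {n k : ℕ} (κ : Colouring n k) where

  edgesOfColours : List (Fin k) → TranspositionList n
  edgesOfColours = concatMap (edgesOfColour κ)

  τ-product : List (Fin k) → Permutation′ n
  τ-product = foldr (λ a π → τ κ a ∘ₚ π) id

  τ-product∈ : ∀ as → InColouringGroup κ (τ-product as)
  τ-product∈ []       = one
  τ-product∈ (a ∷ as) = mul (gen a) (τ-product∈ as)

  τ-product≈eval : ∀ as → τ-product as ≈ eval (edgesOfColours as)
  τ-product≈eval []       x = refl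
  τ-product≈eval (a ∷ as) x = begin
    τ-product as ⟨$⟩ʳ (τ κ a ⟨$⟩ʳ x)
      ≡⟨ τ-product≈eval as _ ⟩
    eval (edgesOfColours as) ⟨$⟩ʳ (τ κ a ⟨$⟩ʳ x)
      ≡⟨ cong (eval (edgesOfColours as) ⟨$⟩ʳ_) (τ≈eval κ a x) ⟩
    eval (edgesOfColours as) ⟨$⟩ʳ (eval (edgesOfColour κ a) ⟨$⟩ʳ x)
      ≡⟨ eval-++ (edgesOfColour κ a) (edgesOfColours as) x ⟨
    eval (edgesOfColours (a ∷ as)) ⟨$⟩ʳ x
      ∎
    where open ≡-Reasoning

  ∈edgesOfColours⁻ : ∀ as {p} → p ∈ edgesOfColours as → ∃[ a ] a ∈ as × IsEdgeOfColour κ a p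
  ∈edgesOfColours⁻ (a ∷ as) p∈ with ∈-++⁻ (edgesOfColour κ a) p∈
  ... | inj₁ p∈a  = a , here refl , ∈edgesOfColour⁻ κ p∈a
  ... | inj₂ p∈as = let b , b∈ , edge = ∈edgesOfColours⁻ as p∈as in b , there b∈ , edge

  ∈edgesOfColours⁺ : ∀ {as a p} → a ∈ as → IsEdgeOfColour κ a p → p ∈ edgesOfColours as
  ∈edgesOfColours⁺ {_ ∷ _}  (here refl) edge = ∈-++⁺ˡ (∈edgesOfColour⁺ κ edge)
  ∈edgesOfColours⁺ {a ∷ _} (there b∈)  edge = ∈-++⁺ʳ (edgesOfColour κ a) (∈edgesOfColours⁺ b∈ edge)

  edgesOfColours-unique : ∀ {as} → Unique as → Unique (edgesOfColours as)
  edgesOfColours-unique {[]}     _              = []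
  edgesOfColours-unique {a ∷ as} (a∉as ∷ unique) =
    Unique.++⁺ (edgesOfColour-unique κ a) (edgesOfColours-unique unique) disjoint
    where
    disjoint : Disjoint (edgesOfColour κ a) (edgesOfColours as)
    disjoint (p∈a , p∈as) with ∈edgesOfColours⁻ as p∈as
    ... | b , b∈as , _ , colour-b = All.lookup a∉as b∈as (Maybe.just-injective (trans (sym colour-a) colour-b))
      where colour-a = proj₂ (∈edgesOfColour⁻ κ p∈a)

-- The forest of the colours outside S

module _ {n k : ℕ} {κ : Colouring n k} (simple : IsSimpleGraph κ) (acyclic : Acyclic κ) where

  IsOrderedEdge : Fin n × Fin n → Set
  IsOrderedEdge (x , y) = x < y × Adj κ x y

  ordered-edges-forest : ∀ {ps} → Unique ps → All IsOrderedEdge ps → IsForest ps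
  ordered-edges-forest {[]}           _                  _                      = tt
  ordered-edges-forest {(a , b) ∷ ps} (ab∉ps ∷ unique) ((a<b , ab) ∷ edges) =
    no-path , ordered-edges-forest unique edges
    where
    joins⇒adj : ∀ {x y} → Joins ps x y → Adj κ x y
    joins⇒adj (inj₁ xy∈) = proj₂ (All.lookup edges xy∈)
    joins⇒adj (inj₂ yx∈) = adj-sym simple (proj₂ (All.lookup edges yx∈))

    no-path : ¬ Connects ps a b
    no-path a⇝b with star⇒simplePath _≟_ a⇝b
    ... | _ , end                        = <-irrefl refl a<b
    ... | _ , step (inj₁ ab∈) end _      = All.lookup ab∉ps ab∈ refl
    ... | _ , step (inj₂ ba∈) end _      = <-asym a<b (proj₁ (All.lookup edges ba∈))
    ... | _ , step _ (step {l = []} _ () _) _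
    ... | _ , p@(step _ (step {l = _ ∷ _} _ _ _) _) =
      acyclic _ (simplePath-unique _≟_ p , simplePath-linked _≟_ joins⇒adj p (adj-sym simple ab))

module _ {n k : ℕ} (κ : Colouring n k) (S : Subset k) where

  coloursOutside : List (Fin k)
  coloursOutside = filter (λ a → ¬? (a Subset.∈? S)) (allFin k)

  forestOutside : TranspositionList n
  forestOutside = edgesOfColours κ coloursOutside

module _ {n k : ℕ} {κ : Colouring n k} (simple : IsSimpleGraph κ) (acyclic : Acyclic κ) (S : Subset k) where

  open OrbitIsComponent

  private
    _∉?S : ∀ a → Dec (a Subset.∉ S)
    a ∉?S = ¬? (a Subset.∈? S)

    F : TranspositionList n
    F = forestOutside κ S

  forestOutside-isForest : IsForest F
  forestOutside-isForest = ordered-edges-forest simple acyclic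
    (edgesOfColours-unique κ (Unique.filter⁺ _∉?S (allFin⁺ k)))
    (All.tabulate λ p∈ → let _ , _ , x<y , xy = ∈edgesOfColours⁻ κ (coloursOutside κ S) p∈ in x<y , _ , xy)

  joins⇒adjWithout : ∀ {x y} → Joins F x y → AdjWithout κ S x y
  joins⇒adjWithout (inj₁ xy∈) with ∈edgesOfColours⁻ κ (coloursOutside κ S) xy∈
  ... | a , a∈ , _ , xy = a , xy , proj₂ (∈-filter⁻ _∉?S {xs = allFin k} a∈)
  joins⇒adjWithout {x} {y} (inj₂ yx∈) with ∈edgesOfColours⁻ κ (coloursOutside κ S) yx∈
  ... | a , a∈ , _ , yx = a , trans (colour-sym simple x y) yx , proj₂ (∈-filter⁻ _∉?S {xs = allFin k} a∈)

  adjWithout⇒joins : ∀ {x y} → AdjWithout κ S x y → Joins F x y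
  adjWithout⇒joins {x} {y} (a , xy , a∉S) with <-cmp x y
  ... | tri< x<y _ _  = inj₁ (∈edgesOfColours⁺ κ a∈ (x<y , xy))
    where a∈ = ∈-filter⁺ _∉?S (∈-allFin a) a∉S
  ... | tri≈ _ refl _ = ⊥-elim (loopless simple xy)
  ... | tri> _ _ y<x  = inj₂ (∈edgesOfColours⁺ κ a∈ (y<x , trans (colour-sym simple y x) xy))
    where a∈ = ∈-filter⁺ _∉?S (∈-allFin a) a∉S

  connects⇔ : ∀ {x y} → Connects F x y ⇔ Star (AdjWithout κ S) x y
  connects⇔ = mk⇔ (Star.map joins⇒adjWithout) (Star.map adjWithout⇒joins)

  orbit-isComponentOf : ∀ {x} (O : OrbitIsComponent F x) → IsComponentOf κ S x (fromList (orbit O))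
  orbit-isComponentOf O y = connects⇔ ⇔-∘ (component O y ⇔-∘ ∈fromList⇔ (orbit O))

module _ {n k : ℕ} {κ : Colouring n k} (simple : IsSimpleGraph κ) (acyclic : Acyclic κ)
         {u v : Fin n} {c : Fin k} (uv : κ u v ≡ just c) {S : Subset k}
         (incident∈S : ∀ x y a → IncidentTo κ (u , v) (x , y) → κ x y ≡ just a → a Subset.∈ S)
         (c∉S : c Subset.∉ S) {root : Fin n}
         (even-reached : ∀ w C → IsComponentOf κ S w C → 2 ∣ ∣ C ∣ → Star (AdjWithout κ S) root w) where

  open OrbitIsComponent

  private
    F : TranspositionList n
    F = forestOutside κ S

    ρ : Fin n → Fin n
    ρ = eval F ⟨$⟩ʳ_

    orbits : ∀ x → OrbitIsComponent F x
    orbits = forest-orbits (forestOutside-isForest simple acyclic S)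

    E : Fin n → Fin n → Set
    E = AdjWithout κ S

    UV : Fin n → Set
    UV y = y ≡ u ⊎ y ≡ v

    u≢v : u ≢ v
    u≢v refl = loopless simple uv

    uv-edge : E u v
    uv-edge = c , uv , c∉S

    edge⇒connects : ∀ {x y} → E x y → Connects F x y
    edge⇒connects e = Equivalence.from (connects⇔ simple acyclic S) (e ◅ ε)

    E-sym : ∀ {x y} → E x y → E y x
    E-sym {x} {y} (a , xy , a∉S) = a , trans (colour-sym simple y x) xy , a∉S

  uv-closed : ∀ {x y} → UV x → E x y → UV y
  uv-closed {y = y} (inj₁ refl) (a , uy , a∉S) with y ≟ v
  ... | yes y≡v = inj₂ y≡v
  ... | no y≢v  = ⊥-elim (a∉S (incident∈S u y a ((a , uy) , inj₁ refl , uy≢uv) uy))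
    where
    uy≢uv : ¬ SameEdge κ (u , y) (u , v)
    uy≢uv (inj₁ (_ , y≡v)) = y≢v y≡v
    uy≢uv (inj₂ (u≡v , _)) = u≢v u≡v
  uv-closed {y = y} (inj₂ refl) (a , vy , a∉S) with y ≟ u
  ... | yes y≡u = inj₁ y≡u
  ... | no y≢u  = ⊥-elim (a∉S (incident∈S v y a ((a , vy) , inj₂ refl , vy≢uv) vy))
    where
    vy≢uv : ¬ SameEdge κ (v , y) (u , v)
    vy≢uv (inj₁ (v≡u , _)) = u≢v (sym v≡u)
    vy≢uv (inj₂ (_ , y≡u)) = y≢u y≡u

  uv-closed⋆ : ∀ {x y} → UV x → Star E x y → UV y
  uv-closed⋆ x∈ ε          = x∈
  uv-closed⋆ x∈ (e ◅ path) = uv-closed⋆ (uv-closed x∈ e) path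

  uv-isComponentOf : IsComponentOf κ S u (fromList (u ∷ v ∷ []))
  uv-isComponentOf y = mk⇔ to from ⇔-∘ ∈fromList⇔ (u ∷ v ∷ [])
    where
    to : y ∈ u ∷ v ∷ [] → Star E u y
    to (here refl)         = ε
    to (there (here refl)) = uv-edge ◅ ε
    from : Star E u y → y ∈ u ∷ v ∷ []
    from path with uv-closed⋆ (inj₁ refl) path
    ... | inj₁ refl = here refl
    ... | inj₂ refl = there (here refl)

  root⇝u : Star E root u
  root⇝u = even-reached u _ uv-isComponentOf (subst (2 ∣_) (sym (∣fromList∣ ((u≢v ∷ []) ∷ [] ∷ []))) ∣-refl)

  other-orbits-odd : ∀ {x} → x ≢ u → x ≢ v → ∃[ j ] suc (2 * j) ℕ.≤ n × iterate ρ x (suc (2 * j)) ≡ x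
  other-orbits-odd {x} x≢u x≢v = odd-orbit (orbits x)
    where
    odd-orbit : (O : OrbitIsComponent F x) → ∃[ j ] suc (2 * j) ℕ.≤ n × iterate ρ x (suc (2 * j)) ≡ x
    odd-orbit O with even-or-odd (length (orbit O))
    ... | inj₁ even = ⊥-elim (Sum.[ x≢u , x≢v ] (uv-closed⋆ (inj₁ refl) (Star.reverse E-sym root⇝u ◅◅ root⇝x)))
      where
      root⇝x : Star E root x
      root⇝x = even-reached x _ (orbit-isComponentOf simple acyclic S O)
                            (subst (2 ∣_) (sym (∣fromList∣ (orbit-unique O))) even)
    ... | inj₂ (j , length≡) =
      j , subst (ℕ._≤ n) (trans (∣fromList∣ (orbit-unique O)) length≡) (Subset.∣p∣≤n (fromList (orbit O)))
        , subst (λ m → iterate ρ x m ≡ x) length≡ (cycle-period (is-cycle O) (here refl))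

  ρu≡v : ρ u ≡ v
  ρu≡v = two-cycle-successor (is-cycle (orbits u)) (here refl)
           (orbit⁺ (orbits u) (edge⇒connects uv-edge)) u≢v
           (uv-closed⋆ (inj₁ refl) ∘ Equivalence.to (connects⇔ simple acyclic S) ∘ orbit⁻ (orbits u))

  ρv≡u : ρ v ≡ u
  ρv≡u = two-cycle-successor (is-cycle (orbits v)) (here refl)
           (orbit⁺ (orbits v) (edge⇒connects (E-sym uv-edge))) (u≢v ∘ sym)
           (Sum.swap ∘ uv-closed⋆ (inj₂ refl) ∘ Equivalence.to (connects⇔ simple acyclic S) ∘ orbit⁻ (orbits v))

  symmetric-edge-swappable : Swappable κ u v
  symmetric-edge-swappable = resp (^ₚ∈ (oddProduct n) (τ-product∈ κ (coloursOutside κ S))) λ i →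
    trans (^ₚ-cong (τ-product≈eval κ (coloursOutside κ S)) (oddProduct n) i)
          (power-is-transposition (eval F) ρu≡v ρv≡u other-orbits-odd i)

theorem3p15 : ∀ (n k : ℕ) (κ : Colouring n k) →
    IsSimpleGraph κ → IsTree κ → IsProper κ → IsSurjective κ →
    HasSymmetricEdge κ → ColouringGroupIsFull κ
theorem3p15 n k κ simple (connected , acyclic) proper _
  (u , v , c , uv , distinct , S , incident∈S , c∉S , root , _ , _ , _ , even-reached) =
  full-if-swappable-edge simple proper uv distinct
    (symmetric-edge-swappable simple acyclic uv incident∈S c∉S even-reached)
    connected
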